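{- Let $(X,C)$ be an instance of 3SAT (variable set $X$, set $C$ of clauses each with exactly three literals). If $C$ has a satisfying truth assignment, then the graph $G_{X,C}$ has a connected matching of weight $|X|+|C|$.
   Context: The edge-weighted graph $G_{X,C}$ is built as follows. (I) For each variable $x_i\in X$, add a triangle on vertices $x_i,x_i^+,x_i^-$, with $w(x_i^+x_i^-)=-1$ and $w(x_ix_i^+)=w(x_ix_i^-)=+1$. (II) For each pair of distinct variables $x_i,x_j$, add all edges between $\{x_i^-,x_i^+\}$ and $\{x_j^-,x_j^+\}$, each of weight $-1$. (III) For each clause $c_i\in C$, add an edge $c_i^+c_i^-$ of weight $+1$, and for each literal of $c_i$ on variable $x_j$, add edges of weight $-1$ from both $c_i^-$ and $c_i^+$ to $x_j^-$ if the literal is negated, and to $x_j^+$ otherwise. For a matching $M$, $V(M)$ is the set of endpoints of its edges, $M$ is connected if the induced subgraph $G_{X,C}[V(M)]$ is connected, and its weight is the sum of its edge weights. -}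

module Defs where

open import Data.Nat using (ℕ)
open import Data.Fin using (Fin)
open import Data.Bool using (Bool; true; false)
open import Data.Integer using (ℤ; +_; -[1+_]; _+_)
open import Data.Product using (_×_; _,_; Σ; ∃; proj₁; proj₂)
open import Data.Sum using (_⊎_)
open import Data.List using (List; []; _∷_)
open import Data.Vec using (Vec)
open import Relation.Binary.PropositionalEquality using (_≡_; _≢_)
import Data.List.Membership.Propositional as LM
import Data.Vec.Membership.Propositional as VM
open import Data.List.Relation.Unary.Unique.Propositional using (Unique)
open import Data.Vec.Relation.Unary.Any using (Any)

-- A literal on variables Fin n: (j , true) is x_j, (j , false) is ¬x_j.
Literal : ℕ → Set
Literal n = Fin n × Bool

Instance : ℕ → ℕ → Set
Instance n m = Fin m → Vec (Literal n) 3

Satisfies : ∀ {n m} → Instance n m → (Fin n → Bool) → Set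
Satisfies {n} C α = ∀ k → Any (λ (l : Literal n) → α (proj₁ l) ≡ proj₂ l) (C k)

data Vertex (n m : ℕ) : Set where
  var  : Fin n → Vertex n m
  xpos : Fin n → Vertex n m
  xneg : Fin n → Vertex n m
  cpos : Fin m → Vertex n m
  cneg : Fin m → Vertex n m

litV : ∀ {n m} → Fin n → Bool → Vertex n m
litV j true  = xpos j
litV j false = xneg j

clV : ∀ {n m} → Fin m → Bool → Vertex n m
clV k true  = cpos k
clV k false = cneg k

minus1 : ℤ
minus1 = -[1+ 0 ]

data Edge {n m : ℕ} (C : Instance n m) : Vertex n m → Vertex n m → ℤ → Set where
  tri⁺  : ∀ i → Edge C (var i) (xpos i) (+ 1)
  tri⁻  : ∀ i → Edge C (var i) (xneg i) (+ 1)
  tri±  : ∀ i → Edge C (xpos i) (xneg i) minus1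
  cross : ∀ i j → i ≢ j → (a b : Bool) → Edge C (litV i a) (litV j b) minus1
  cl±   : ∀ k → Edge C (cpos k) (cneg k) (+ 1)
  clLit : ∀ k j b → (j , b) VM.∈ C k → (s : Bool) → Edge C (clV k s) (litV j b) minus1

Adj : ∀ {n m} → Instance n m → Vertex n m → Vertex n m → ℤ → Set
Adj C u v z = Edge C u v z ⊎ Edge C v u z

record GEdge {n m : ℕ} (C : Instance n m) : Set where
  constructor gedge
  field
    u v : Vertex n m
    w   : ℤ
    adj : Adj C u v w
open GEdge public

VM : ∀ {n m} {C : Instance n m} → List (GEdge C) → List (Vertex n m)
VM []       = []
VM (e ∷ es) = u e ∷ v e ∷ VM es

weight : ∀ {n m} {C : Instance n m} → List (GEdge C) → ℤ
weight []       = + 0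
weight (e ∷ es) = w e + weight es

-- M is a matching: its edges are pairwise vertex-disjoint (and, being
-- edges of a loopless graph, have distinct endpoints), i.e. all listed
-- endpoints are distinct.
IsMatching : ∀ {n m} {C : Instance n m} → List (GEdge C) → Set
IsMatching M = Unique (VM M)

data Reach {n m} (C : Instance n m) (S : Vertex n m → Set) : Vertex n m → Vertex n m → Set where
  here : ∀ {u} → Reach C S u u
  step : ∀ {u w v z} → S w → Adj C u w z → Reach C S w v → Reach C S u v

IsConnected : ∀ {n m} {C : Instance n m} → List (GEdge C) → Set
IsConnected {C = C} M = ∀ x y → x LM.∈ VM M → y LM.∈ VM M → Reach C (λ t → t LM.∈ VM M) x y

-- Match every variable x_i with the literal vertex it makes true under α and
-- every clause vertex c_k^+ with c_k^-: these n + m edges all have weight +1.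
-- The chosen literal vertices are pairwise adjacent (edges of type (II)), and
-- every other matched vertex is adjacent to one of them: x_i to its own, and
-- c_k^± to the literal satisfying c_k. So the matched vertices induce a
-- connected subgraph.
module Submission where

open import Defs
open import Data.Nat using (ℕ; _+_)
open import Data.Fin using (Fin; splitAt; join; _≟_)
open import Data.Fin.Properties using (splitAt-join; join-splitAt)
open import Data.Bool using (Bool; true; false)
open import Data.Integer using (+_)
open import Data.List using (List; []; _∷_; map; allFin; length)
open import Data.List.Properties using (length-tabulate)
open import Data.List.Membership.Propositional using (_∈_)
open import Data.List.Membership.Propositional.Properties using (∈-allFin)
open import Data.List.Relation.Unary.Any using (here; there)
open import Data.List.Relation.Unary.All as All using ()
open import Data.List.Relation.Unary.AllPairs using ([]; _∷_)
open import Data.List.Relation.Unary.Unique.Propositional using (Unique)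
open import Data.List.Relation.Unary.Unique.Propositional.Properties using (allFin⁺)
open import Data.Vec.Membership.Propositional.Properties using (fromAny)
open import Data.Product using (Σ; _×_; _,_; ∃)
open import Data.Empty using (⊥-elim)
open import Data.Sum using (_⊎_; inj₁; inj₂)
open import Function using (_∘_)
open import Function.Definitions using (Injective)
open import Relation.Nullary using (yes; no)
open import Relation.Binary.PropositionalEquality using (_≡_; _≢_; refl; sym; trans; cong; subst)

module _ {n m : ℕ} {C : Instance n m} where

  ∈-VM-map⁻ : ∀ {A : Set} {x} (e : A → GEdge C) (l : List A) → x ∈ VM (map e l) →
              Σ A λ a → a ∈ l × (x ≡ u (e a) ⊎ x ≡ v (e a))
  ∈-VM-map⁻ e (a ∷ l) (here x≡u)         = a , here refl , inj₁ x≡u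
  ∈-VM-map⁻ e (a ∷ l) (there (here x≡v)) = a , here refl , inj₂ x≡v
  ∈-VM-map⁻ e (a ∷ l) (there (there x∈)) with ∈-VM-map⁻ e l x∈
  ... | b , b∈l , x≡ = b , there b∈l , x≡

  v∈-VM-map⁺ : ∀ {A : Set} {a} (e : A → GEdge C) {l : List A} → a ∈ l → v (e a) ∈ VM (map e l)
  v∈-VM-map⁺ e (here refl) = there (here refl)
  v∈-VM-map⁺ e (there a∈l) = there (there (v∈-VM-map⁺ e a∈l))

  unique-VM-map : ∀ {A : Set} (e : A → GEdge C) →
                  Injective _≡_ _≡_ (u ∘ e) → Injective _≡_ _≡_ (v ∘ e) →
                  (∀ a b → u (e a) ≢ v (e b)) →
                  {l : List A} → Unique l → Unique (VM (map e l))
  unique-VM-map e u-inj v-inj u≢v {[]}    [] = []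
  unique-VM-map e u-inj v-inj u≢v {a ∷ l} (a∉l ∷ uniq-l) =
    All.tabulate u-fresh ∷ All.tabulate v-fresh ∷ unique-VM-map e u-inj v-inj u≢v uniq-l
    where
      u-fresh : ∀ {x} → x ∈ v (e a) ∷ VM (map e l) → u (e a) ≢ x
      u-fresh (here refl) = u≢v a a
      u-fresh (there x∈) with ∈-VM-map⁻ e l x∈
      ... | b , b∈l , inj₁ refl = All.lookup a∉l b∈l ∘ u-inj
      ... | b , b∈l , inj₂ refl = u≢v a b

      v-fresh : ∀ {x} → x ∈ VM (map e l) → v (e a) ≢ x
      v-fresh x∈ with ∈-VM-map⁻ e l x∈
      ... | b , b∈l , inj₁ refl = u≢v b a ∘ sym
      ... | b , b∈l , inj₂ refl = All.lookup a∉l b∈l ∘ v-inj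

  weight-map-unit : ∀ {A : Set} (e : A → GEdge C) → (∀ a → w (e a) ≡ + 1) →
                    (l : List A) → weight (map e l) ≡ + length l
  weight-map-unit e w≡1 []      = refl
  weight-map-unit e w≡1 (a ∷ l) rewrite w≡1 a | weight-map-unit e w≡1 l = refl

  Near : Vertex n m → Vertex n m → Set
  Near x y = x ≡ y ⊎ ∃ (Adj C x y)

  Near-sym : ∀ {x y} → Near x y → Near y x
  Near-sym (inj₁ refl)            = inj₁ refl
  Near-sym (inj₂ (z , inj₁ edge)) = inj₂ (z , inj₂ edge)
  Near-sym (inj₂ (z , inj₂ edge)) = inj₂ (z , inj₁ edge)

  module _ {S : Vertex n m → Set} where

    Reach-trans : ∀ {x y z} → Reach C S x y → Reach C S y z → Reach C S x z
    Reach-trans here               q = q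
    Reach-trans (step s∈ edge p) q = step s∈ edge (Reach-trans p q)

    Near⇒Reach : ∀ {x y} → S y → Near x y → Reach C S x y
    Near⇒Reach y∈ (inj₁ refl)       = here
    Near⇒Reach y∈ (inj₂ (z , edge)) = step y∈ edge here

    connected-if-dominated-by-clique :
      ∀ {I : Set} (hub : I → Vertex n m) → (∀ j → S (hub j)) →
      (∀ i j → Near (hub i) (hub j)) →
      (∀ {x} → S x → Σ I λ j → Near x (hub j)) →
      ∀ x y → S x → S y → Reach C S x y
    connected-if-dominated-by-clique hub hub∈ clique dominated x y x∈ y∈
      with dominated x∈ | dominated y∈
    ... | i , x~i | j , y~j =
      Reach-trans (Near⇒Reach (hub∈ i) x~i)
        (Reach-trans (Near⇒Reach (hub∈ j) (clique i j))
          (Near⇒Reach y∈ (Near-sym y~j)))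

splitAt-injective : ∀ n {m} → Injective _≡_ _≡_ (splitAt n {m})
splitAt-injective n {m} {i} {j} eq =
  trans (sym (join-splitAt n m i)) (trans (cong (join n m) eq) (join-splitAt n m j))

litV-injective : ∀ {n m i j} a b → litV {n} {m} i a ≡ litV j b → i ≡ j
litV-injective true  true  refl = refl
litV-injective false false refl = refl

var≢litV : ∀ {n m} i j b → var {n} {m} i ≢ litV j b
var≢litV i j true  ()
var≢litV i j false ()

cpos≢litV : ∀ {n m} k j b → cpos {n} {m} k ≢ litV j b
cpos≢litV k j true  ()
cpos≢litV k j false ()

cneg≢litV : ∀ {n m} k j b → cneg {n} {m} k ≢ litV j b
cneg≢litV k j true  ()
cneg≢litV k j false ()

var-litV-edge : ∀ {n m} {C : Instance n m} i b → Edge C (var i) (litV i b) (+ 1)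
var-litV-edge i true  = tri⁺ i
var-litV-edge i false = tri⁻ i

module _ {n m : ℕ} (C : Instance n m) (α : Fin n → Bool) where

  trueLit : Fin n → Vertex n m
  trueLit j = litV j (α j)

  matchEdge : Fin n ⊎ Fin m → GEdge C
  matchEdge (inj₁ i) = gedge (var i) (trueLit i) (+ 1) (inj₁ (var-litV-edge i (α i)))
  matchEdge (inj₂ k) = gedge (cpos k) (cneg k) (+ 1) (inj₁ (cl± k))

  -- Indexing by Fin (n + m) ≅ Fin n ⊎ Fin m makes the edge list duplicate-free via allFin⁺.
  matching : List (GEdge C)
  matching = map (matchEdge ∘ splitAt n) (allFin (n + m))

  matchEdge-weight : ∀ s → w (matchEdge s) ≡ + 1
  matchEdge-weight (inj₁ i) = refl
  matchEdge-weight (inj₂ k) = refl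

  matchEdge-u-injective : Injective _≡_ _≡_ (u ∘ matchEdge)
  matchEdge-u-injective {inj₁ i} {inj₁ j} refl = refl
  matchEdge-u-injective {inj₂ k} {inj₂ l} refl = refl

  matchEdge-v-injective : Injective _≡_ _≡_ (v ∘ matchEdge)
  matchEdge-v-injective {inj₁ i} {inj₁ j} eq = cong inj₁ (litV-injective (α i) (α j) eq)
  matchEdge-v-injective {inj₁ i} {inj₂ l} eq = ⊥-elim (cneg≢litV l i (α i) (sym eq))
  matchEdge-v-injective {inj₂ k} {inj₁ j} eq = ⊥-elim (cneg≢litV k j (α j) eq)
  matchEdge-v-injective {inj₂ k} {inj₂ l} refl = refl

  matchEdge-u≢v : ∀ s t → u (matchEdge s) ≢ v (matchEdge t)
  matchEdge-u≢v (inj₁ i) (inj₁ j) = var≢litV i j (α j)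
  matchEdge-u≢v (inj₁ i) (inj₂ l) ()
  matchEdge-u≢v (inj₂ k) (inj₁ j) = cpos≢litV k j (α j)
  matchEdge-u≢v (inj₂ k) (inj₂ l) ()

  matching-isMatching : IsMatching matching
  matching-isMatching =
    unique-VM-map (matchEdge ∘ splitAt n)
      (splitAt-injective n ∘ matchEdge-u-injective)
      (splitAt-injective n ∘ matchEdge-v-injective)
      (λ a b → matchEdge-u≢v (splitAt n a) (splitAt n b))
      (allFin⁺ (n + m))

  matching-weight : weight matching ≡ + (n + m)
  matching-weight
    rewrite weight-map-unit (matchEdge ∘ splitAt n) (matchEdge-weight ∘ splitAt n) (allFin (n + m))
          | length-tabulate {n = n + m} (λ i → i) = refl

  trueLit∈matching : ∀ j → trueLit j ∈ VM matching
  trueLit∈matching j =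
    subst (λ s → v (matchEdge s) ∈ VM matching) (splitAt-join n m (inj₁ j))
      (v∈-VM-map⁺ (matchEdge ∘ splitAt n) (∈-allFin (join n m (inj₁ j))))

  trueLits-clique : ∀ i j → Near {C = C} (trueLit i) (trueLit j)
  trueLits-clique i j with i ≟ j
  ... | yes refl = inj₁ refl
  ... | no  i≢j  = inj₂ (_ , inj₁ (cross i j i≢j (α i) (α j)))

  clause-near-trueLit : Satisfies C α → ∀ k → Σ (Fin n) λ j → ∀ s → Near {C = C} (clV k s) (trueLit j)
  clause-near-trueLit sat k with fromAny (sat k)
  ... | (j , b) , lit∈ , refl = j , λ s → inj₂ (_ , inj₁ (clLit k j (α j) lit∈ s))

  matching-dominated : Satisfies C α → ∀ {x} → x ∈ VM matching → Σ (Fin n) λ j → Near {C = C} x (trueLit j)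
  matching-dominated sat x∈ with ∈-VM-map⁻ (matchEdge ∘ splitAt n) (allFin (n + m)) x∈
  ... | a , _ , x≡ = endpoint-near (splitAt n a) x≡
    where
      endpoint-near : ∀ {x} c → x ≡ u (matchEdge c) ⊎ x ≡ v (matchEdge c) →
                      Σ (Fin n) λ j → Near {C = C} x (trueLit j)
      endpoint-near (inj₁ i) (inj₁ refl) = i , inj₂ (_ , inj₁ (var-litV-edge i (α i)))
      endpoint-near (inj₁ i) (inj₂ refl) = i , inj₁ refl
      endpoint-near (inj₂ k) (inj₁ refl) with clause-near-trueLit sat k
      ... | j , near = j , near true
      endpoint-near (inj₂ k) (inj₂ refl) with clause-near-trueLit sat k
      ... | j , near = j , near false

  matching-isConnected : Satisfies C α → IsConnected matching
  matching-isConnected sat =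
    connected-if-dominated-by-clique trueLit trueLit∈matching trueLits-clique (matching-dominated sat)

lemma1 : (n m : ℕ) (C : Instance n m) → (α : Fin n → Bool) → Satisfies C α →
    Σ (List (GEdge C)) (λ M → IsMatching M × IsConnected M × (weight M ≡ + (n + m)))
lemma1 n m C α sat =
  matching C α , matching-isMatching C α , matching-isConnected C α sat , matching-weight C α
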